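{- In the partizan restricted chocolate bar game described below, with the sets $\mathcal{P},\mathcal{L},\mathcal{R},\mathcal{N}$ defined below: (i) if Left is to move from a position in $\mathcal{L}$, then either she wins at once (by eating the last piece) or she can move to a position in $\mathcal{L}\cup\mathcal{P}$; (ii) if Right is to move from a position in $\mathcal{R}$, then either he wins at once (by eating the last piece) or he can move to a position in $\mathcal{R}\cup\mathcal{P}$; (iii) if Right is to move from a position in $\mathcal{L}$, then either he loses (has no move) or every move of his leads to a position in $\mathcal{L}\cup\mathcal{N}$; (iv) if Left is to move from a position in $\mathcal{R}$, then either she loses (has no move) or every move of hers leads to a position in $\mathcal{R}\cup\mathcal{N}$.
   Context: A black-and-white chocolate bar $(x,y,s)$ with $x,y\in\mathbb{N}$, $s\in\{0,1\}$, is an $x\times y$ matrix (height $x$, width $y$) with entries in $\{0,1\}$ (1 = black, 0 = white) in a checkerboard pattern whose top-left entry is $s$: entry $(i,j)$ is $s$ if $i+j$ is even and $1-s$ otherwise. Partizan restricted chocolate bar game: players Left and Right alternate. On a move, the player cuts the bar along one horizontal or vertical grid line into two nonempty rectangular pieces and eats one of them; the other piece is the new position. Left may eat a piece only if it contains no more black (1) blocks than the other piece (if equal she may eat either); Right may eat a piece only if it contains no more white (0) blocks than the other (if equal, either). In addition, Left may eat the single white block $(1,1,0)$ and Right may eat the single black block $(1,1,1)$, leaving the empty bar, denoted $(0,0)$. A player who cannot move loses. Sets: $\mathcal{P}_a=\{(2^n(2p+5)-1,2^m(2p+5)-1,s): n,m,p\in\mathbb{Z}_{\ge0}, s\in\{0,1\}\}$,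 $\mathcal{P}_b=\{(2^n3-1,2^m4-1,s): n,m\in\mathbb{Z}_{\ge0}, s\in\{0,1\}\}$, $\mathcal{P}_c=\{(2^n4-1,2^m3-1,s): n,m\in\mathbb{Z}_{\ge0}, s\in\{0,1\}\}$, $\mathcal{P}=\mathcal{P}_a\cup\mathcal{P}_b\cup\mathcal{P}_c\cup\{(1,2,s),(2,1,s):s\in\{0,1\}\}\cup\{(0,0)\}$. $\mathcal{L}=\{(2n+5,1,0),(1,2n+5,0):n\in\mathbb{Z}_{\ge0}\}\cup\{(1,1,0)\}$. $\mathcal{R}=\{(2n+5,1,1),(1,2n+5,1):n\in\mathbb{Z}_{\ge0}\}\cup\{(1,1,1)\}$. $\mathcal{N}=\{(x,y,s):x,y\in\mathbb{N}, s\in\{0,1\}\}\setminus(\mathcal{P}\cup\mathcal{L}\cup\mathcal{R})$. -}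

module Defs where

open import Data.Nat using (ℕ; zero; suc; _+_; _*_; _∸_; _^_; _≤_; _<_)
open import Data.Nat.Base using (_%_)
open import Data.Bool using (Bool; true; false; not; if_then_else_)
open import Data.Bool.Properties using () renaming (_≟_ to _≟ᵇ_)
open import Data.Product using (Σ; ∃; _×_; _,_)
open import Data.Sum using (_⊎_)
open import Relation.Nullary using (¬_; does)
open import Relation.Binary.PropositionalEquality using (_≡_)

-- Colours: true = 1 = black, false = 0 = white.

-- A position: the empty bar (0,0), or a bar (x,y,s) of height x, width y,
-- top-left entry s.  Only bars with x,y ≥ 1 are reachable / in the sets below.
data Pos : Set where
  empty : Pos
  bar   : ℕ → ℕ → Bool → Pos

-- Entry (i,j) of the checkerboard with top-left s (0-indexed; parity of i+j
-- is the same as in the 1-indexed convention of the paper).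
entry : Bool → ℕ → ℕ → Bool
entry s i j = if does ((i + j) % 2 Data.Nat.≟ 0) then s else not s
  where import Data.Nat

rowCount : Bool → ℕ → ℕ → Bool → ℕ
rowCount s i zero    c = 0
rowCount s i (suc j) c = rowCount s i j c + (if does (entry s i j ≟ᵇ c) then 1 else 0)

colorCount : Bool → ℕ → ℕ → Bool → ℕ
colorCount s zero    b c = 0
colorCount s (suc i) b c = colorCount s i b c + rowCount s i b c

blacks : Pos → ℕ
blacks empty       = 0
blacks (bar x y s) = colorCount s x y true

whites : Pos → ℕ
whites empty       = 0
whites (bar x y s) = colorCount s x y false

-- Cut p e r : cutting p along a grid line into two nonempty pieces,
-- e is the eaten piece and r the remaining one.
data Cut : Pos → Pos → Pos → Set where
  eatTop    : ∀ {x y s k} → 1 ≤ k → k < x →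
              Cut (bar x y s) (bar k y s) (bar (x ∸ k) y (entry s k 0))
  eatBottom : ∀ {x y s k} → 1 ≤ k → k < x →
              Cut (bar x y s) (bar (x ∸ k) y (entry s k 0)) (bar k y s)
  eatLeft   : ∀ {x y s k} → 1 ≤ k → k < y →
              Cut (bar x y s) (bar x k s) (bar x (y ∸ k) (entry s 0 k))
  eatRight  : ∀ {x y s k} → 1 ≤ k → k < y →
              Cut (bar x y s) (bar x (y ∸ k) (entry s 0 k)) (bar x k s)

LeftMove : Pos → Pos → Set
LeftMove p q = (Σ Pos λ e → Cut p e q × blacks e ≤ blacks q)
             ⊎ (p ≡ bar 1 1 false × q ≡ empty)

RightMove : Pos → Pos → Set
RightMove p q = (Σ Pos λ e → Cut p e q × whites e ≤ whites q)
              ⊎ (p ≡ bar 1 1 true × q ≡ empty)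

InPa : Pos → Set
InPa empty = Data.Empty.⊥ where import Data.Empty
InPa (bar x y s) = Σ ℕ λ n → Σ ℕ λ m → Σ ℕ λ p →
  (x ≡ 2 ^ n * (2 * p + 5) ∸ 1) × (y ≡ 2 ^ m * (2 * p + 5) ∸ 1)

InPb : Pos → Set
InPb empty = Data.Empty.⊥ where import Data.Empty
InPb (bar x y s) = Σ ℕ λ n → Σ ℕ λ m → (x ≡ 2 ^ n * 3 ∸ 1) × (y ≡ 2 ^ m * 4 ∸ 1)

InPc : Pos → Set
InPc empty = Data.Empty.⊥ where import Data.Empty
InPc (bar x y s) = Σ ℕ λ n → Σ ℕ λ m → (x ≡ 2 ^ n * 4 ∸ 1) × (y ≡ 2 ^ m * 3 ∸ 1)

InP : Pos → Set
InP p = InPa p ⊎ InPb p ⊎ InPc p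
      ⊎ (Σ Bool λ s → p ≡ bar 1 2 s) ⊎ (Σ Bool λ s → p ≡ bar 2 1 s)
      ⊎ p ≡ empty

InL : Pos → Set
InL p = (Σ ℕ λ n → p ≡ bar (2 * n + 5) 1 false)
      ⊎ (Σ ℕ λ n → p ≡ bar 1 (2 * n + 5) false)
      ⊎ p ≡ bar 1 1 false

InR : Pos → Set
InR p = (Σ ℕ λ n → p ≡ bar (2 * n + 5) 1 true)
      ⊎ (Σ ℕ λ n → p ≡ bar 1 (2 * n + 5) true)
      ⊎ p ≡ bar 1 1 true

InN : Pos → Set
InN empty = Data.Empty.⊥ where import Data.Empty
InN (bar x y s) = 1 ≤ x × 1 ≤ y
  × ¬ InP (bar x y s) × ¬ InL (bar x y s) × ¬ InR (bar x y s)

-- A position of L ∪ R is an alternating strip, of length 1 or of odd length at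
-- least 5, whose corner colour c is white for L and black for R; it has one block
-- of colour c more than of the other colour. Its owner eats an end domino, which
-- leaves an odd strip two shorter, or, from length 5, eats three blocks and keeps
-- a domino, which lies in P. The opponent counts colour c, of which the strip has
-- at least three, so the piece he keeps is never a domino; an odd end piece again
-- starts with c, so the remainder is in L ∪ R, or it is an even strip or a strip
-- of length 3, and these lie in N.

module Submission where

open import Defs
open import Data.Bool using (Bool; true; false; not; if_then_else_)
open import Data.Bool.Properties using (not-involutive; not-injective; not-¬)
  renaming (_≟_ to _≟ᵇ_)
open import Data.Empty using (⊥-elim)
open import Data.Nat using (ℕ; zero; suc; _+_; _*_; _∸_; _^_; _≤_; _<_; z≤n; s≤s)
open import Data.Nat.Properties
open import Data.Product using (Σ; ∃; _×_; _,_)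
open import Data.Sum using (_⊎_; inj₁; inj₂; [_,_]′)
open import Function using (_∘′_)
open import Relation.Nullary using (¬_; does)
open import Relation.Binary.PropositionalEquality

stripColour : Bool → ℕ → Bool
stripColour c zero    = c
stripColour c (suc k) = not (stripColour c k)

indicator : Bool → Bool → ℕ
indicator b d = if does (b ≟ᵇ d) then 1 else 0

stripCount : Bool → ℕ → Bool → ℕ
stripCount c zero    d = 0
stripCount c (suc l) d = stripCount c l d + indicator (stripColour c l) d

indicator-self : ∀ c → indicator c c ≡ 1
indicator-self false = refl
indicator-self true  = refl

indicator-opposite : ∀ c → indicator c (not c) ≡ 0
indicator-opposite false = refl
indicator-opposite true  = refl

indicator-complement : ∀ b d → indicator b d + indicator (not b) d ≡ 1
indicator-complement false false = refl
indicator-complement false true  = refl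
indicator-complement true  false = refl
indicator-complement true  true  = refl

stripColour-+ : ∀ c a b → stripColour c (a + b) ≡ stripColour (stripColour c a) b
stripColour-+ c a zero    = cong (stripColour c) (+-identityʳ a)
stripColour-+ c a (suc b) =
  trans (cong (stripColour c) (+-suc a b)) (cong not (stripColour-+ c a b))

stripColour-even : ∀ c m → stripColour c (2 * m) ≡ c
stripColour-even c zero    = refl
stripColour-even c (suc m) =
  trans (cong (stripColour c) (*-suc 2 m))
        (trans (not-involutive _) (stripColour-even c m))

stripColour-odd : ∀ c m → stripColour c (suc (2 * m)) ≡ not c
stripColour-odd c m = cong not (stripColour-even c m)

stripCount-+ : ∀ c a b d →
  stripCount c (a + b) d ≡ stripCount c a d + stripCount (stripColour c a) b d
stripCount-+ c a zero d =
  trans (cong (λ l → stripCount c l d) (+-identityʳ a)) (sym (+-identityʳ _))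
stripCount-+ c a (suc b) d = begin
  stripCount c (a + suc b) d
    ≡⟨ cong (λ l → stripCount c l d) (+-suc a b) ⟩
  stripCount c (a + b) d + indicator (stripColour c (a + b)) d
    ≡⟨ cong₂ _+_ (stripCount-+ c a b d) (cong (λ b → indicator b d) (stripColour-+ c a b)) ⟩
  stripCount c a d + stripCount (stripColour c a) b d
    + indicator (stripColour (stripColour c a) b) d
    ≡⟨ +-assoc (stripCount c a d) _ _ ⟩
  stripCount c a d + stripCount (stripColour c a) (suc b) d
    ∎
  where open ≡-Reasoning

stripCount-2+ : ∀ c l d → stripCount c (2 + l) d ≡ suc (stripCount c l d)
stripCount-2+ c l d = begin
  stripCount c l d + indicator b d + indicator (not b) d
    ≡⟨ +-assoc (stripCount c l d) _ _ ⟩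
  stripCount c l d + (indicator b d + indicator (not b) d)
    ≡⟨ cong (stripCount c l d +_) (indicator-complement b d) ⟩
  stripCount c l d + 1
    ≡⟨ +-comm (stripCount c l d) 1 ⟩
  suc (stripCount c l d)
    ∎
  where open ≡-Reasoning
        b = stripColour c l

stripCount-even : ∀ c m d → stripCount c (2 * m) d ≡ m
stripCount-even c zero    d = refl
stripCount-even c (suc m) d =
  trans (cong (λ l → stripCount c l d) (*-suc 2 m))
        (trans (stripCount-2+ c (2 * m) d) (cong suc (stripCount-even c m d)))

stripCount-odd : ∀ c m d → stripCount c (suc (2 * m)) d ≡ m + indicator c d
stripCount-odd c m d =
  cong₂ _+_ (stripCount-even c m d) (cong (λ b → indicator b d) (stripColour-even c m))

long≡odd : ∀ n → 5 + 2 * n ≡ suc (2 * (2 + n))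
long≡odd n = cong suc (sym (*-distribˡ-+ 2 2 n))

data Strip : ℕ → Bool → Pos → Set where
  column : ∀ {l c} → Strip l c (bar l 1 c)
  row    : ∀ {l c} → Strip l c (bar 1 l c)

recolour : ∀ {l s s' p} → s ≡ s' → Strip l s p → Strip l s' p
recolour {l} {p = p} eq = subst (λ s → Strip l s p) eq

strip-length-unique : ∀ {r r' t t' q} → Strip r t q → Strip r' t' q → r ≡ r'
strip-length-unique column column = refl
strip-length-unique column row    = refl
strip-length-unique row    column = refl
strip-length-unique row    row    = refl

unit-strip : ∀ {t q} → Strip 1 t q → q ≡ bar 1 1 t
unit-strip column = refl
unit-strip row    = refl

entry-row : ∀ c k → entry c 0 k ≡ stripColour c k
entry-row c zero          = refl
entry-row c (suc zero)    = refl
entry-row c (suc (suc k)) = trans (entry-row c k) (sym (not-involutive _))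

entry-column : ∀ c k → entry c k 0 ≡ stripColour c k
entry-column c k = trans (cong (entry c 0) (+-identityʳ k)) (entry-row c k)

count : Bool → Pos → ℕ
count true  = blacks
count false = whites

count-bar : ∀ d x y s → count d (bar x y s) ≡ colorCount s x y d
count-bar true  x y s = refl
count-bar false x y s = refl

column-count : ∀ c l d → colorCount c l 1 d ≡ stripCount c l d
column-count c zero    d = refl
column-count c (suc l) d =
  cong₂ _+_ (column-count c l d) (cong (λ b → indicator b d) (entry-column c l))

row-count : ∀ c l d → colorCount c 1 l d ≡ stripCount c l d
row-count c zero    d = refl
row-count c (suc l) d =
  cong₂ _+_ (row-count c l d) (cong (λ b → indicator b d) (entry-row c l))

count-strip : ∀ {l c p} → Strip l c p → ∀ d → count d p ≡ stripCount c l d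
count-strip {l} {c} column d = trans (count-bar d l 1 c) (column-count c l d)
count-strip {l} {c} row    d = trans (count-bar d 1 l c) (row-count c l d)

domino-count : ∀ {t q} → Strip 2 t q → ∀ d → count d q ≡ 1
domino-count {t} s d = trans (count-strip s d) (stripCount-even t 1 d)

data Split (c : Bool) (l : ℕ) (h t : Pos) : Set where
  split : ∀ a b → a + b ≡ l → 1 ≤ a → 1 ≤ b →
          Strip a c h → Strip b (stripColour c a) t → Split c l h t

split-at : ∀ {c l k h t} → 1 ≤ k → k < l →
           Strip k c h → Strip (l ∸ k) (stripColour c k) t → Split c l h t
split-at {k = k} 1≤k k<l =
  split k _ (m+[n∸m]≡n (<⇒≤ k<l)) 1≤k (m<n⇒0<n∸m k<l)

cut-splits : ∀ {l c p e q} → Strip l c p → Cut p e q → Split c l e q ⊎ Split c l q e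
cut-splits {c = c} column (eatTop {k = k} 1≤k k<l) =
  inj₁ (split-at 1≤k k<l column (recolour (entry-column c k) column))
cut-splits {c = c} column (eatBottom {k = k} 1≤k k<l) =
  inj₂ (split-at 1≤k k<l column (recolour (entry-column c k) column))
cut-splits column (eatLeft   (s≤s z≤n) (s≤s ()))
cut-splits column (eatRight  (s≤s z≤n) (s≤s ()))
cut-splits row    (eatTop    (s≤s z≤n) (s≤s ()))
cut-splits row    (eatBottom (s≤s z≤n) (s≤s ()))
cut-splits {c = c} row (eatLeft {k = k} 1≤k k<l) =
  inj₁ (split-at 1≤k k<l row (recolour (entry-row c k) row))
cut-splits {c = c} row (eatRight {k = k} 1≤k k<l) =
  inj₂ (split-at 1≤k k<l row (recolour (entry-row c k) row))

head-tail-cuts : ∀ {a b c p} → Strip (a + b) c p → 1 ≤ a → 1 ≤ b →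
  Σ Pos λ h → Σ Pos λ t → Strip a c h × Strip b (stripColour c a) t × Cut p h t × Cut p t h
head-tail-cuts {a} {b} {c} column 1≤a 1≤b =
  _ , _ , column , column ,
  subst (Cut (bar (a + b) 1 c) (bar a 1 c)) tail≡ (eatTop 1≤a (m<m+n a 1≤b)) ,
  subst (λ t → Cut (bar (a + b) 1 c) t (bar a 1 c)) tail≡ (eatBottom 1≤a (m<m+n a 1≤b))
  where
  tail≡ : bar (a + b ∸ a) 1 (entry c a 0) ≡ bar b 1 (stripColour c a)
  tail≡ = cong₂ (λ l s → bar l 1 s) (m+n∸m≡n a b) (entry-column c a)
head-tail-cuts {a} {b} {c} row 1≤a 1≤b =
  _ , _ , row , row ,
  subst (Cut (bar 1 (a + b) c) (bar 1 a c)) tail≡ (eatLeft 1≤a (m<m+n a 1≤b)) ,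
  subst (λ t → Cut (bar 1 (a + b) c) t (bar 1 a c)) tail≡ (eatRight 1≤a (m<m+n a 1≤b))
  where
  tail≡ : bar 1 (a + b ∸ a) (entry c 0 a) ≡ bar 1 b (stripColour c a)
  tail≡ = cong₂ (bar 1) (m+n∸m≡n a b) (entry-row c a)

split-count : ∀ {c l h t} → Split c l h t → ∀ d → count d h + count d t ≡ stripCount c l d
split-count {c} (split a b refl _ _ sh st) d =
  trans (cong₂ _+_ (count-strip sh d) (count-strip st d)) (sym (stripCount-+ c a b d))

count-cut : ∀ {l c p e q} → Strip l c p → Cut p e q → ∀ d → count d e + count d q ≡ count d p
count-cut {e = e} {q} s cut d with cut-splits s cut
... | inj₁ sp = trans (split-count sp d) (sym (count-strip s d))
... | inj₂ sp =
  trans (+-comm (count d e) (count d q)) (trans (split-count sp d) (sym (count-strip s d)))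

stripColour-at-odd-suffix : ∀ c a b m j → a + b ≡ suc (2 * m) → b ≡ suc (2 * j) →
                            stripColour c a ≡ c
stripColour-at-odd-suffix c a b m j a+b≡ b≡ = not-injective (begin
  not (stripColour c a)                  ≡⟨ sym (stripColour-odd (stripColour c a) j) ⟩
  stripColour (stripColour c a) (suc (2 * j)) ≡⟨ cong (stripColour _) (sym b≡) ⟩
  stripColour (stripColour c a) b        ≡⟨ sym (stripColour-+ c a b) ⟩
  stripColour c (a + b)                  ≡⟨ cong (stripColour c) a+b≡ ⟩
  stripColour c (suc (2 * m))            ≡⟨ stripColour-odd c m ⟩
  not c                                  ∎)
  where open ≡-Reasoning

-- InLR false and InLR true unfold to InL and InR; likewise PlayerMove true and
-- PlayerMove false below unfold to LeftMove and RightMove.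
InLR : Bool → Pos → Set
InLR c p = (Σ ℕ λ n → p ≡ bar (2 * n + 5) 1 c)
         ⊎ (Σ ℕ λ n → p ≡ bar 1 (2 * n + 5) c)
         ⊎ p ≡ bar 1 1 c

data LRView (c : Bool) : Pos → Set where
  cell : LRView c (bar 1 1 c)
  long : ∀ n {p} → Strip (5 + 2 * n) c p → LRView c p

lrView : ∀ {c p} → InLR c p → LRView c p
lrView {c} (inj₁ (n , refl)) =
  long n (subst (λ l → Strip l c (bar (2 * n + 5) 1 c)) (+-comm (2 * n) 5) column)
lrView {c} (inj₂ (inj₁ (n , refl))) =
  long n (subst (λ l → Strip l c (bar 1 (2 * n + 5) c)) (+-comm (2 * n) 5) row)
lrView (inj₂ (inj₂ refl)) = cell

strip-InLR : ∀ {n c q} → Strip (5 + 2 * n) c q → InLR c q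
strip-InLR {n} {c} column = inj₁ (n , cong (λ l → bar l 1 c) (+-comm 5 (2 * n)))
strip-InLR {n} {c} row    = inj₂ (inj₁ (n , cong (λ l → bar 1 l c) (+-comm 5 (2 * n))))

bar-colour-injective : ∀ {x y s x' y' s'} → bar x y s ≡ bar x' y' s' → s ≡ s'
bar-colour-injective refl = refl

LRView-≢-opposite-cell : ∀ {c p} → LRView c p → p ≢ bar 1 1 (not c)
LRView-≢-opposite-cell cell            eq = not-¬ refl (bar-colour-injective eq)
LRView-≢-opposite-cell (long _ column) eq = not-¬ refl (bar-colour-injective eq)
LRView-≢-opposite-cell (long _ row)    eq = not-¬ refl (bar-colour-injective eq)

LRLength : ℕ → Set
LRLength r = r ≡ 1 ⊎ ∃ λ n → r ≡ 5 + 2 * n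

strip-InLR-length : ∀ {r t c q} → Strip r t q → InLR c q → LRLength r
strip-InLR-length s h with lrView h
... | cell      = inj₁ (strip-length-unique s column)
... | long n s' = inj₂ (n , strip-length-unique s s')

1≢2^m*a∸1 : ∀ m a → 3 ≤ a → 1 ≢ 2 ^ m * a ∸ 1
1≢2^m*a∸1 m a 3≤a eq =
  <-irrefl eq (∸-monoˡ-≤ 1 (≤-trans 3≤a (m≤n*m a (2 ^ m) {{m^n≢0 2 m}})))

3≤4 : 3 ≤ 4
3≤4 = s≤s (s≤s (s≤s z≤n))

3≤2*p+5 : ∀ p → 3 ≤ 2 * p + 5
3≤2*p+5 p = ≤-trans (m≤n+m 3 2) (m≤n+m 5 (2 * p))

strip-InP-length : ∀ {r t q} → Strip r t q → InP q → r ≡ 2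
strip-InP-length column (inj₁ (_ , m , p , _ , y≡)) = ⊥-elim (1≢2^m*a∸1 m _ (3≤2*p+5 p) y≡)
strip-InP-length column (inj₂ (inj₁ (_ , m , _ , y≡))) = ⊥-elim (1≢2^m*a∸1 m 4 3≤4 y≡)
strip-InP-length column (inj₂ (inj₂ (inj₁ (_ , m , _ , y≡)))) = ⊥-elim (1≢2^m*a∸1 m 3 ≤-refl y≡)
strip-InP-length column (inj₂ (inj₂ (inj₂ (inj₁ (_ , ())))))
strip-InP-length column (inj₂ (inj₂ (inj₂ (inj₂ (inj₁ (_ , refl)))))) = refl
strip-InP-length column (inj₂ (inj₂ (inj₂ (inj₂ (inj₂ ())))))
strip-InP-length row (inj₁ (n , _ , p , x≡ , _)) = ⊥-elim (1≢2^m*a∸1 n _ (3≤2*p+5 p) x≡)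
strip-InP-length row (inj₂ (inj₁ (n , _ , x≡ , _))) = ⊥-elim (1≢2^m*a∸1 n 3 ≤-refl x≡)
strip-InP-length row (inj₂ (inj₂ (inj₁ (n , _ , x≡ , _)))) = ⊥-elim (1≢2^m*a∸1 n 4 3≤4 x≡)
strip-InP-length row (inj₂ (inj₂ (inj₂ (inj₁ (_ , refl))))) = refl
strip-InP-length row (inj₂ (inj₂ (inj₂ (inj₂ (inj₁ (_ , ()))))))
strip-InP-length row (inj₂ (inj₂ (inj₂ (inj₂ (inj₂ ())))))

domino-InP : ∀ {t q} → Strip 2 t q → InP q
domino-InP {t} column = inj₂ (inj₂ (inj₂ (inj₂ (inj₁ (t , refl)))))
domino-InP {t} row    = inj₂ (inj₂ (inj₂ (inj₁ (t , refl))))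

strip-outside : ∀ {r t q} → Strip r t q → r ≢ 2 → ¬ LRLength r → ¬ InP q × ¬ InL q × ¬ InR q
strip-outside s r≢2 ¬LR =
  r≢2 ∘′ strip-InP-length s , ¬LR ∘′ strip-InLR-length s , ¬LR ∘′ strip-InLR-length s

strip-InN : ∀ {r t q} → Strip r t q → 1 ≤ r → r ≢ 2 → ¬ LRLength r → InN q
strip-InN column 1≤r r≢2 ¬LR = 1≤r , s≤s z≤n , strip-outside column r≢2 ¬LR
strip-InN row    1≤r r≢2 ¬LR = s≤s z≤n , 1≤r , strip-outside row r≢2 ¬LR

data LengthView : ℕ → Set where
  len0 : LengthView 0
  len1 : LengthView 1
  len2 : LengthView 2
  len3 : LengthView 3
  even : ∀ j → LengthView (4 + 2 * j)
  odd  : ∀ j → LengthView (5 + 2 * j)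

lengthView : ∀ n → LengthView n
lengthView zero       = len0
lengthView (suc zero) = len1
lengthView (suc (suc n)) with lengthView n
... | len0   = len2
... | len1   = len3
... | len2   = even 0
... | len3   = odd 0
... | even j = subst LengthView (cong (4 +_) (*-suc 2 j)) (even (suc j))
... | odd  j = subst LengthView (cong (5 +_) (*-suc 2 j)) (odd (suc j))

classify-strip : ∀ {r t c q} → Strip r t q → 1 ≤ r → r ≢ 2 →
                 (∀ j → r ≡ suc (2 * j) → t ≡ c) → InLR c q ⊎ InN q
classify-strip {r} s 1≤r r≢2 odd⇒c with lengthView r
classify-strip s () r≢2 odd⇒c | len0
... | len1   = inj₁ (inj₂ (inj₂ (trans (unit-strip s) (cong (bar 1 1) (odd⇒c 0 refl)))))
... | len2   = ⊥-elim (r≢2 refl)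
... | len3   = inj₂ (strip-InN s 1≤r (λ ()) [ (λ ()) , (λ { (_ , ()) }) ]′)
... | even j = inj₂ (strip-InN s 1≤r (λ ()) [ (λ ()) , (λ { (n , eq) → not-odd n eq }) ]′)
  where
  not-odd : ∀ n → 4 + 2 * j ≢ 5 + 2 * n
  not-odd n eq = even≢odd j n (+-cancelˡ-≡ 4 _ _ eq)
... | odd  j = inj₁ (strip-InLR {j} (recolour (odd⇒c (2 + j) (long≡odd j)) s))

CutMove : Bool → Pos → Pos → Set
CutMove d p q = Σ Pos λ e → Cut p e q × count d e ≤ count d q

PlayerMove : Bool → Pos → Pos → Set
PlayerMove d p q = CutMove d p q ⊎ (p ≡ bar 1 1 (not d) × q ≡ empty)

cell-uncuttable : ∀ {c e q} → ¬ Cut (bar 1 1 c) e q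
cell-uncuttable (eatTop    (s≤s z≤n) (s≤s ()))
cell-uncuttable (eatBottom (s≤s z≤n) (s≤s ()))
cell-uncuttable (eatLeft   (s≤s z≤n) (s≤s ()))
cell-uncuttable (eatRight  (s≤s z≤n) (s≤s ()))

long-strip-owner-move : ∀ n {c p} → Strip (5 + 2 * n) c p →
  Σ Pos λ q → CutMove (not c) p q × (InLR c q ⊎ InP q)
long-strip-owner-move zero {c} s with head-tail-cuts {3} {2} s (s≤s z≤n) (s≤s z≤n)
... | h , t , sh , st , h-eaten , _ =
  t , (h , h-eaten , ≤-reflexive h≡t) , inj₂ (domino-InP st)
  where
  h≡t : count (not c) h ≡ count (not c) t
  h≡t = begin
    count (not c) h                ≡⟨ count-strip sh (not c) ⟩
    stripCount c 3 (not c)         ≡⟨ stripCount-odd c 1 (not c) ⟩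
    1 + indicator c (not c)        ≡⟨ cong (1 +_) (indicator-opposite c) ⟩
    1                              ≡⟨ sym (domino-count st (not c)) ⟩
    count (not c) t                ∎
    where open ≡-Reasoning
long-strip-owner-move (suc m) {c} {p} s
  with head-tail-cuts {2} {5 + 2 * m} (subst (λ l → Strip l c p) (cong (5 +_) (*-suc 2 m)) s)
                      (s≤s z≤n) (s≤s z≤n)
... | h , t , sh , st , h-eaten , _ =
  t , (h , h-eaten , h≤t) , inj₁ (strip-InLR {m} (recolour (not-involutive c) st))
  where
  h≤t : count (not c) h ≤ count (not c) t
  h≤t = subst₂ _≤_ (sym (domino-count sh (not c)))
          (sym (trans (count-strip st (not c)) (stripCount-2+ _ (3 + 2 * m) (not c))))
          (s≤s z≤n)

no-domino-remainder : ∀ n {c p e q t} → Strip (5 + 2 * n) c p → Cut p e q →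
                      count c e ≤ count c q → ¬ Strip 2 t q
no-domino-remainder n {c} {p} {e} {q} s cut e≤q sq = <-irrefl refl (begin
  3                                   ≤⟨ s≤s (s≤s (m≤n+m 1 n)) ⟩
  2 + n + 1                           ≡⟨ cong (2 + n +_) (sym (indicator-self c)) ⟩
  2 + n + indicator c c               ≡⟨ sym (stripCount-odd c (2 + n) c) ⟩
  stripCount c (suc (2 * (2 + n))) c  ≡⟨ cong (λ l → stripCount c l c) (sym (long≡odd n)) ⟩
  stripCount c (5 + 2 * n) c          ≡⟨ sym (count-strip s c) ⟩
  count c p                           ≡⟨ sym (count-cut s cut c) ⟩
  count c e + count c q               ≤⟨ +-monoˡ-≤ (count c q) e≤q ⟩
  count c q + count c q               ≡⟨ cong₂ _+_ (domino-count sq c) (domino-count sq c) ⟩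
  2                                   ∎)
  where open ≤-Reasoning

long-strip-opponent-move : ∀ n {c p e q} → Strip (5 + 2 * n) c p → Cut p e q →
                           count c e ≤ count c q → InLR c q ⊎ InN q
long-strip-opponent-move n {c} s cut e≤q with cut-splits s cut
... | inj₁ (split a b a+b≡ _ 1≤b _ st) =
  classify-strip st 1≤b not-domino
    (λ j → stripColour-at-odd-suffix c a b (2 + n) j (trans a+b≡ (long≡odd n)))
  where
  not-domino : b ≢ 2
  not-domino refl = no-domino-remainder n s cut e≤q st
... | inj₂ (split a b _ 1≤a _ sh _) = classify-strip sh 1≤a not-domino (λ _ _ → refl)
  where
  not-domino : a ≢ 2
  not-domino refl = no-domino-remainder n s cut e≤q sh

owner-move : ∀ c p → InLR c p →
  PlayerMove (not c) p empty ⊎ (Σ Pos λ q → PlayerMove (not c) p q × (InLR c q ⊎ InP q))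
owner-move c p h with lrView h
... | cell     = inj₁ (inj₂ (cong (bar 1 1) (sym (not-involutive c)) , refl))
... | long n s = let q , move , q∈ = long-strip-owner-move n s in inj₂ (q , inj₁ move , q∈)

opponent-move : ∀ c p → InLR c p → ∀ q → PlayerMove c p q → InLR c q ⊎ InN q
opponent-move c p h q (inj₂ (p≡ , _)) = ⊥-elim (LRView-≢-opposite-cell (lrView h) p≡)
opponent-move c p h q (inj₁ (e , cut , e≤q)) with lrView h
... | cell     = ⊥-elim (cell-uncuttable cut)
... | long n s = long-strip-opponent-move n s cut e≤q

lemma4p13 :
    (∀ p → InL p → LeftMove p empty
        ⊎ (Σ Pos λ q → LeftMove p q × (InL q ⊎ InP q)))
    × (∀ p → InR p → RightMove p empty
        ⊎ (Σ Pos λ q → RightMove p q × (InR q ⊎ InP q)))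
    × (∀ p → InL p → (¬ (Σ Pos λ q → RightMove p q))
        ⊎ (∀ q → RightMove p q → InL q ⊎ InN q))
    × (∀ p → InR p → (¬ (Σ Pos λ q → LeftMove p q))
        ⊎ (∀ q → LeftMove p q → InR q ⊎ InN q))
lemma4p13 =
  owner-move false ,
  owner-move true ,
  (λ p h → inj₂ (opponent-move false p h)) ,
  (λ p h → inj₂ (opponent-move true p h))
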